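{- Let $n\ge1$, let $a>1$ be a real number, and let \[ P(x)=1+s_1x+\cdots+s_{n-1}x^{n-1}+s_nx^n+s_{n-1}x^{n+1}+\cdots+s_1x^{2n-1}+x^{2n} \] be a symmetric polynomial with real coefficients which is unimodal with a unique mode. Then $Q(x)=(1+ax+x^2)\cdot P(x)$ is symmetric and unimodal with a unique mode, and this mode is equal to $n+1$.
   Context: A finite sequence $(a_0,\dots,a_N)$ is unimodal if there is an index $k$ (a mode) with $a_0\le\cdots\le a_{k-1}\le a_k\ge a_{k+1}\ge\cdots\ge a_N$; the mode is unique if exactly one index $k$ has this property. It is symmetric if $a_i=a_{N-i}$ for all $i$. A polynomial is unimodal/symmetric if its coefficient sequence $(a_0,\dots,a_N)$, $N$ the degree, is. -}

module Defs where

open import Level using (0ℓ)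
open import Data.Nat as ℕ using (ℕ; zero; suc; _∸_)
open import Data.List using (List; []; _∷_; map; length)
open import Data.Product using (_×_; ∃)
open import Relation.Binary.PropositionalEquality using (_≡_; _≢_)
open import Relation.Binary.Structures using (IsTotalOrder)
open import Algebra.Structures using (IsCommutativeRing)

record OrderedField : Set₁ where
  infixl 7 _*_
  infixl 6 _+_
  infix 4 _≤_
  field
    Carrier : Set
    _+_ _*_ : Carrier → Carrier → Carrier
    -_ : Carrier → Carrier
    0# 1# : Carrier
    _≤_ : Carrier → Carrier → Set
    isCommutativeRing : IsCommutativeRing _≡_ _+_ _*_ -_ 0# 1#
    isTotalOrder : IsTotalOrder _≡_ _≤_
    0≢1 : 0# ≢ 1#
    inverse : ∀ x → x ≢ 0# → ∃ λ y → x * y ≡ 1#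
    +-monoˡ-≤ : ∀ {x y} z → x ≤ y → x + z ≤ y + z
    *-nonneg : ∀ {x y} → 0# ≤ x → 0# ≤ y → 0# ≤ x * y

  _<_ : Carrier → Carrier → Set
  x < y = x ≤ y × x ≢ y

module _ (F : OrderedField) where
  open OrderedField F

  -- Polynomials are coefficient lists (a₀ , … , a_N), lowest degree first.
  -- i-th coefficient (0 outside the range).
  coeff : List Carrier → ℕ → Carrier
  coeff []       _       = 0#
  coeff (x ∷ _)  zero    = x
  coeff (_ ∷ xs) (suc i) = coeff xs i

  topIndex : List Carrier → ℕ
  topIndex xs = length xs ∸ 1

  addPoly : List Carrier → List Carrier → List Carrier
  addPoly []       ys       = ys
  addPoly xs       []       = xs
  addPoly (x ∷ xs) (y ∷ ys) = (x + y) ∷ addPoly xs ys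

  mulPoly : List Carrier → List Carrier → List Carrier
  mulPoly []       _  = []
  mulPoly _        [] = []
  mulPoly (x ∷ xs) ys = addPoly (map (x *_) ys) (0# ∷ mulPoly xs ys)

  Symmetric : List Carrier → Set
  Symmetric xs = ∀ i → i ℕ.≤ topIndex xs → coeff xs i ≡ coeff xs (topIndex xs ∸ i)

  IsMode : List Carrier → ℕ → Set
  IsMode xs k =
    k ℕ.≤ topIndex xs
    × (∀ i → i ℕ.< k → coeff xs i ≤ coeff xs (suc i))
    × (∀ i → k ℕ.≤ i → i ℕ.< topIndex xs → coeff xs (suc i) ≤ coeff xs i)

  IsUniqueMode : List Carrier → ℕ → Set
  IsUniqueMode xs k = IsMode xs k × (∀ j → IsMode xs j → j ≡ k)

  UnimodalUniqueMode : List Carrier → Set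
  UnimodalUniqueMode xs = ∃ λ k → IsUniqueMode xs k

-- By symmetry the mirror image of a mode of P is again a mode, so the unique mode of P is
-- its centre n, and p_(n-1) < p_n since otherwise n - 1 would be a mode as well.  The
-- coefficients q_i = p_i + a p_(i-1) + p_(i-2) of Q are symmetric about n + 1 and weakly
-- increase up to n + 1, termwise.  Using p_(n+1) = p_(n-1),
--   q_(n+1) - q_n = (a - 1)(p_n - p_(n-1)) + (p_(n-1) - p_(n-2)) > 0,
-- and q_(n+2) = q_n by symmetry, so no index other than n + 1 is a mode of Q.
module Submission where

open import Defs
open import Data.Nat as ℕ using (ℕ; zero; suc; _∸_; s≤s; s≤s⁻¹)
import Data.Nat.Properties as ℕₚ
open import Data.List using (List; []; _∷_; map; length)
open import Data.List.Properties using (length-map)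
open import Data.Product using (_×_; _,_; ∃; proj₁; proj₂)
open import Data.Sum using (inj₁; inj₂)
open import Data.Empty using (⊥-elim)
open import Function using (_∘_)
open import Relation.Nullary using (¬_)
open import Relation.Binary.Definitions using (Reflexive; tri<; tri≈; tri>)
open import Relation.Binary.PropositionalEquality
open import Relation.Binary.Structures using (IsTotalOrder)
open import Algebra.Bundles using (CommutativeRing)
open import Algebra.Structures using (IsCommutativeRing)

module Sequences {A : Set} (_≤_ : A → A → Set) where

  open import Data.Nat using (_+_; _*_)
  open ℕₚ using (m≤m+n; m≤n+m; m+n∸m≡n; m+[n∸m]≡n; m∸n+n≡m; +-suc; +-identityʳ;
                 +-cancelʳ-≤; *-cancelˡ-≡; <⇒≤; m<n⇒m<1+n; m≤n⇒m<n∨m≡n; n<1+n; 1+n≢n; <-cmp)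

  Palindromic : ℕ → (ℕ → A) → Set
  Palindromic T f = ∀ i j → i + j ≡ T → f i ≡ f j

  RisingTo : ℕ → (ℕ → A) → Set
  RisingTo k f = ∀ i → i ℕ.< k → f i ≤ f (suc i)

  FallingOn : ℕ → ℕ → (ℕ → A) → Set
  FallingOn k T f = ∀ i → k ℕ.≤ i → i ℕ.< T → f (suc i) ≤ f i

  IsModeOn : ℕ → (ℕ → A) → ℕ → Set
  IsModeOn T f k = k ℕ.≤ T × RisingTo k f × FallingOn k T f

  IsUniqueModeOn : ℕ → (ℕ → A) → ℕ → Set
  IsUniqueModeOn T f k = IsModeOn T f k × (∀ j → IsModeOn T f j → j ≡ k)

  ∸-symmetric⇒palindromic : ∀ {T f} → (∀ i → i ℕ.≤ T → f i ≡ f (T ∸ i)) → Palindromic T f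
  ∸-symmetric⇒palindromic {f = f} symmetric i j refl =
    trans (symmetric i (m≤m+n i j)) (cong f (m+n∸m≡n i j))

  palindromic⇒∸-symmetric : ∀ {T f} → Palindromic T f → ∀ i → i ℕ.≤ T → f i ≡ f (T ∸ i)
  palindromic⇒∸-symmetric pal i i≤T = pal i _ (m+[n∸m]≡n i≤T)

  palindromic-resp-≗ : ∀ {T f g} → f ≗ g → Palindromic T f → Palindromic T g
  palindromic-resp-≗ f≗g pal i j i+j≡T = trans (sym (f≗g i)) (trans (pal i j i+j≡T) (f≗g j))

  palindromic-centre-neighbours : ∀ {m f} → Palindromic (2 * suc m) f → f (suc (suc m)) ≡ f m
  palindromic-centre-neighbours {m} pal =
    pal (suc (suc m)) m (cong suc (trans (sym (+-suc m m)) (cong (λ l → m + suc l) (sym (+-identityʳ m)))))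

  isModeOn-resp-≗ : ∀ {T f g k} → f ≗ g → IsModeOn T f k → IsModeOn T g k
  isModeOn-resp-≗ f≗g (k≤T , rise , fall) =
    k≤T ,
    (λ i i<k → subst₂ _≤_ (f≗g i) (f≗g (suc i)) (rise i i<k)) ,
    (λ i k≤i i<T → subst₂ _≤_ (f≗g (suc i)) (f≗g i) (fall i k≤i i<T))

  isUniqueModeOn-resp-≗ : ∀ {T f g k} → f ≗ g → IsUniqueModeOn T f k → IsUniqueModeOn T g k
  isUniqueModeOn-resp-≗ f≗g (mode , unique) =
    isModeOn-resp-≗ f≗g mode , λ j → unique j ∘ isModeOn-resp-≗ (sym ∘ f≗g)

  risingTo⇒fallingOn : ∀ {T f k k′} → Palindromic T f → k + k′ ≡ T → RisingTo k f → FallingOn k′ T f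
  risingTo⇒fallingOn {T} {f} {k} {k′} pal k+k′≡T rise i k′≤i i<T =
    subst₂ _≤_ (pal j (suc i) j+1+i≡T) (pal (suc j) i 1+j+i≡T) (rise j j<k)
    where
    open ℕₚ.≤-Reasoning
    j = T ∸ suc i
    j+1+i≡T : j + suc i ≡ T
    j+1+i≡T = m∸n+n≡m i<T
    1+j+i≡T : suc j + i ≡ T
    1+j+i≡T = trans (sym (+-suc j i)) j+1+i≡T
    j<k : j ℕ.< k
    j<k = +-cancelʳ-≤ i (suc j) k (begin
      suc j + i ≡⟨ 1+j+i≡T ⟩
      T         ≡⟨ sym k+k′≡T ⟩
      k + k′    ≤⟨ ℕₚ.+-monoʳ-≤ k k′≤i ⟩
      k + i     ∎)

  fallingOn⇒risingTo : ∀ {T f k k′} → Palindromic T f → k + k′ ≡ T → FallingOn k T f → RisingTo k′ f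
  fallingOn⇒risingTo {T} {f} {k} {k′} pal k+k′≡T fall i i<k′ =
    subst₂ _≤_ (pal (suc j) i 1+j+i≡T) (pal j (suc i) j+1+i≡T) (fall j k≤j j<T)
    where
    open ℕₚ.≤-Reasoning
    j = T ∸ suc i
    j+1+i≡T : j + suc i ≡ T
    j+1+i≡T = m∸n+n≡m (ℕₚ.≤-trans i<k′ (subst (k′ ℕ.≤_) k+k′≡T (m≤n+m k′ k)))
    1+j+i≡T : suc j + i ≡ T
    1+j+i≡T = trans (sym (+-suc j i)) j+1+i≡T
    j<T : j ℕ.< T
    j<T = subst (suc j ℕ.≤_) 1+j+i≡T (m≤m+n (suc j) i)
    k≤j : k ℕ.≤ j
    k≤j = +-cancelʳ-≤ k′ k j (begin
      k + k′    ≡⟨ k+k′≡T ⟩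
      T         ≡⟨ sym j+1+i≡T ⟩
      j + suc i ≤⟨ ℕₚ.+-monoʳ-≤ j i<k′ ⟩
      j + k′    ∎)

  isModeOn-mirror : ∀ {T f k k′} → Palindromic T f → k + k′ ≡ T → IsModeOn T f k → IsModeOn T f k′
  isModeOn-mirror {k = k} {k′} pal k+k′≡T (_ , rise , fall) =
    subst (k′ ℕ.≤_) k+k′≡T (m≤n+m k′ k) ,
    fallingOn⇒risingTo pal k+k′≡T fall ,
    risingTo⇒fallingOn pal k+k′≡T rise

  uniqueModeOn-palindromic⇒centre : ∀ {n f k} → Palindromic (2 * n) f → IsUniqueModeOn (2 * n) f k → k ≡ n
  uniqueModeOn-palindromic⇒centre {n} {f} {k} pal (mode@(k≤T , _) , unique) = *-cancelˡ-≡ k n 2 (begin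
      2 * k            ≡⟨ cong (k +_) (+-identityʳ k) ⟩
      k + k            ≡⟨ cong (k +_) (sym mirror≡k) ⟩
      k + (2 * n ∸ k)  ≡⟨ m+[n∸m]≡n k≤T ⟩
      2 * n            ∎)
    where
    open ≡-Reasoning
    mirror≡k : 2 * n ∸ k ≡ k
    mirror≡k = unique (2 * n ∸ k) (isModeOn-mirror pal (m+[n∸m]≡n k≤T) mode)

  -- A plateau just before the mode would make its left end a second mode.
  uniqueModeOn⇒strictRise : ∀ {T f m} → Reflexive _≤_ → IsUniqueModeOn T f (suc m) → f m ≢ f (suc m)
  uniqueModeOn⇒strictRise {T} {f} {m} ≤-refl ((m<T , rise , fall) , unique) fm≡f1+m =
    1+n≢n (sym (unique m (<⇒≤ m<T , (λ i i<m → rise i (m<n⇒m<1+n i<m)) , fallingFromM)))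
    where
    fallingFromM : FallingOn m T f
    fallingFromM i m≤i i<T with m≤n⇒m<n∨m≡n m≤i
    ... | inj₁ m<i  = fall i m<i i<T
    ... | inj₂ refl = subst (_≤ f m) fm≡f1+m ≤-refl

  risingTo-suc : ∀ {k f} → RisingTo k f → f k ≤ f (suc k) → RisingTo (suc k) f
  risingTo-suc rise step i (s≤s i≤k) with m≤n⇒m<n∨m≡n i≤k
  ... | inj₁ i<k  = rise i i<k
  ... | inj₂ refl = step

  strictRise⇒uniqueModeOn : ∀ {m f} → Palindromic (2 * suc m) f → RisingTo (suc m) f → ¬ (f (suc m) ≤ f m) →
                            IsUniqueModeOn (2 * suc m) f (suc m)
  strictRise⇒uniqueModeOn {m} {f} pal rise noFall =
    (1+m≤T , rise , risingTo⇒fallingOn pal 1+m+1+m≡T rise) , unique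
    where
    1+m+1+m≡T : suc m + suc m ≡ 2 * suc m
    1+m+1+m≡T = cong (suc m +_) (sym (+-identityʳ (suc m)))
    1+m≤T : suc m ℕ.≤ 2 * suc m
    1+m≤T = m≤m+n (suc m) _
    unique : ∀ j → IsModeOn (2 * suc m) f j → j ≡ suc m
    unique j (_ , riseⱼ , fallⱼ) with <-cmp j (suc m)
    ... | tri< j<1+m _ _ = ⊥-elim (noFall (fallⱼ m (s≤s⁻¹ j<1+m) (ℕₚ.<-≤-trans (n<1+n m) 1+m≤T)))
    ... | tri≈ _ j≡1+m _ = j≡1+m
    ... | tri> _ _ 1+m<j =
      ⊥-elim (noFall (subst (f (suc m) ≤_) (palindromic-centre-neighbours pal) (riseⱼ (suc m) 1+m<j)))

module OrderedFieldProperties (F : OrderedField) where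

  open OrderedField F
  open IsCommutativeRing isCommutativeRing
    using (+-comm; +-identityˡ; +-identityʳ; -‿inverseˡ; -‿inverseʳ;
           *-comm; *-assoc; *-identityˡ; zeroʳ; distribˡ)
  open IsTotalOrder isTotalOrder using (total; antisym) renaming (trans to ≤-trans)

  commutativeRing : CommutativeRing _ _
  commutativeRing = record { isCommutativeRing = isCommutativeRing }

  open import Algebra.Properties.Ring (CommutativeRing.ring commutativeRing) using (-1*x≈-x)
  open import Algebra.Properties.Group (CommutativeRing.+-group commutativeRing)
    using (\\-leftDividesˡ; identityʳ-unique; ⁻¹-involutive)
  open import Relation.Binary.Construct.NonStrictToStrict _≡_ _≤_
    using () renaming (<-≤-trans to <-≤-trans′)

  <-≤-trans : ∀ {x y z} → x < y → y ≤ z → x < z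
  <-≤-trans = <-≤-trans′ sym ≤-trans antisym (λ {x} → subst (x ≤_))

  +-monoʳ-≤ : ∀ z {x y} → x ≤ y → z + x ≤ z + y
  +-monoʳ-≤ z {x} {y} x≤y = subst₂ _≤_ (+-comm x z) (+-comm y z) (+-monoˡ-≤ z x≤y)

  +-mono-≤ : ∀ {x y u v} → x ≤ y → u ≤ v → x + u ≤ y + v
  +-mono-≤ {y = y} {u} x≤y u≤v = ≤-trans (+-monoˡ-≤ u x≤y) (+-monoʳ-≤ y u≤v)

  x≤x+d : ∀ x {d} → 0# ≤ d → x ≤ x + d
  x≤x+d x 0≤d = subst (_≤ x + _) (+-identityʳ x) (+-monoʳ-≤ x 0≤d)

  x<x+d : ∀ x {d} → 0# < d → x < (x + d)
  x<x+d x {d} (0≤d , 0≢d) = x≤x+d x 0≤d , λ x≡x+d → 0≢d (sym (identityʳ-unique x d (sym x≡x+d)))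

  0≤1 : 0# ≤ 1#
  0≤1 with total 0# 1#
  ... | inj₁ 0≤1 = 0≤1
  ... | inj₂ 1≤0 = subst (0# ≤_) (trans (-1*x≈-x (- 1#)) (⁻¹-involutive 1#)) (*-nonneg 0≤-1 0≤-1)
    where
    0≤-1 : 0# ≤ - 1#
    0≤-1 = subst₂ _≤_ (-‿inverseʳ 1#) (+-identityˡ (- 1#)) (+-monoˡ-≤ (- 1#) 1≤0)

  ≤⇒nonNeg-difference : ∀ {x y} → x ≤ y → ∃ λ d → 0# ≤ d × y ≡ x + d
  ≤⇒nonNeg-difference {x} {y} x≤y =
    - x + y , subst (_≤ - x + y) (-‿inverseˡ x) (+-monoʳ-≤ (- x) x≤y) , sym (\\-leftDividesˡ x y)

  <⇒pos-difference : ∀ {x y} → x < y → ∃ λ d → 0# < d × y ≡ x + d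
  <⇒pos-difference {x} (x≤y , x≢y) with ≤⇒nonNeg-difference x≤y
  ... | d , 0≤d , refl = d , (0≤d , λ 0≡d → x≢y (sym (trans (cong (x +_) (sym 0≡d)) (+-identityʳ x)))) , refl

  *-pos : ∀ {x y} → 0# < x → 0# < y → 0# < (x * y)
  *-pos {x} {y} (0≤x , 0≢x) (0≤y , 0≢y) = *-nonneg 0≤x 0≤y , 0≢y ∘ y≡0 ∘ sym
    where
    open ≡-Reasoning
    y≡0 : x * y ≡ 0# → 0# ≡ y
    y≡0 xy≡0 with inverse x (0≢x ∘ sym)
    ... | x⁻¹ , xx⁻¹≡1 = sym (begin
      y              ≡⟨ sym (*-identityˡ y) ⟩
      1# * y         ≡⟨ cong (_* y) (trans (sym xx⁻¹≡1) (*-comm x x⁻¹)) ⟩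
      x⁻¹ * x * y    ≡⟨ *-assoc x⁻¹ x y ⟩
      x⁻¹ * (x * y)  ≡⟨ cong (x⁻¹ *_) xy≡0 ⟩
      x⁻¹ * 0#       ≡⟨ zeroʳ x⁻¹ ⟩
      0#             ∎)

  *-monoʳ-≤-nonNeg : ∀ {c x y} → 0# ≤ c → x ≤ y → c * x ≤ c * y
  *-monoʳ-≤-nonNeg {c} {x} 0≤c x≤y with ≤⇒nonNeg-difference x≤y
  ... | d , 0≤d , refl = subst (c * x ≤_) (sym (distribˡ c x d)) (x≤x+d (c * x) (*-nonneg 0≤c 0≤d))

  open import Algebra.Solver.Ring.NaturalCoefficients.Default (CommutativeRing.commutativeSemiring commutativeRing)
    using (solve; _:=_; _:+_; _:*_; con)

  +-rotate : ∀ x y z → x + (y + z) ≡ z + (y + x)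
  +-rotate = solve 3 (λ x y z → x :+ (y :+ z) := z :+ (y :+ x)) refl

  -- Writing s = u + e, t = s + d and a = 1 + b, the right side exceeds the left by b d + e.
  centralRise : ∀ {a u s t} → 1# < a → u ≤ s → s < t → (t + (a * s + u)) < (s + (a * t + s))
  centralRise {u = u} 1<a u≤s s<t with ≤⇒nonNeg-difference u≤s | <⇒pos-difference s<t | <⇒pos-difference 1<a
  ... | e , 0≤e , refl | d , 0<d , refl | b , 0<b , refl =
    subst ((((u + e) + d) + ((1# + b) * (u + e) + u)) <_) (sym (expand u e d b))
          (<-≤-trans (x<x+d _ (*-pos 0<b 0<d)) (x≤x+d _ 0≤e))
    where
    expand : ∀ u e d b → (u + e) + ((1# + b) * ((u + e) + d) + (u + e))
                       ≡ ((((u + e) + d) + ((1# + b) * (u + e) + u)) + b * d) + e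
    expand = solve 4 (λ u e d b → (u :+ e) :+ ((con 1 :+ b) :* ((u :+ e) :+ d) :+ (u :+ e))
                                  := ((((u :+ e) :+ d) :+ ((con 1 :+ b) :* (u :+ e) :+ u)) :+ b :* d) :+ e) refl

module Coefficients (F : OrderedField) where

  open OrderedField F
  open IsCommutativeRing isCommutativeRing using (+-identityˡ; +-identityʳ; zeroʳ)

  shift : (ℕ → Carrier) → ℕ → Carrier
  shift f zero    = 0#
  shift f (suc i) = f i

  shift-cong : ∀ {f g} → f ≗ g → shift f ≗ shift g
  shift-cong f≗g zero    = refl
  shift-cong f≗g (suc i) = f≗g i

  shift-*-+ : ∀ c f g → shift (λ i → c * f i + g i) ≗ λ i → c * shift f i + shift g i
  shift-*-+ c f g zero    = sym (trans (+-identityʳ (c * 0#)) (zeroʳ c))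
  shift-*-+ c f g (suc i) = refl

  coeff-≥length : ∀ xs {i} → length xs ℕ.≤ i → coeff F xs i ≡ 0#
  coeff-≥length []       _         = refl
  coeff-≥length (x ∷ xs) (s≤s len≤i) = coeff-≥length xs len≤i

  coeff-addPoly : ∀ xs ys i → coeff F (addPoly F xs ys) i ≡ coeff F xs i + coeff F ys i
  coeff-addPoly []       ys       i       = sym (+-identityˡ _)
  coeff-addPoly (x ∷ xs) []       i       = sym (+-identityʳ _)
  coeff-addPoly (x ∷ xs) (y ∷ ys) zero    = refl
  coeff-addPoly (x ∷ xs) (y ∷ ys) (suc i) = coeff-addPoly xs ys i

  coeff-map-* : ∀ c ys i → coeff F (map (c *_) ys) i ≡ c * coeff F ys i
  coeff-map-* c []       i       = sym (zeroʳ c)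
  coeff-map-* c (y ∷ ys) zero    = refl
  coeff-map-* c (y ∷ ys) (suc i) = coeff-map-* c ys i

  coeff-0∷ : ∀ xs → coeff F (0# ∷ xs) ≗ shift (coeff F xs)
  coeff-0∷ xs zero    = refl
  coeff-0∷ xs (suc i) = refl

  coeff-mulPoly-∷ : ∀ x xs y ys i →
    coeff F (mulPoly F (x ∷ xs) (y ∷ ys)) i ≡ x * coeff F (y ∷ ys) i + shift (coeff F (mulPoly F xs (y ∷ ys))) i
  coeff-mulPoly-∷ x xs y ys i =
    trans (coeff-addPoly (map (x *_) (y ∷ ys)) (0# ∷ mulPoly F xs (y ∷ ys)) i)
          (cong₂ _+_ (coeff-map-* x (y ∷ ys) i) (coeff-0∷ (mulPoly F xs (y ∷ ys)) i))

  length-addPoly : ∀ xs ys → length (addPoly F xs ys) ≡ length xs ℕ.⊔ length ys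
  length-addPoly []       ys       = refl
  length-addPoly (x ∷ xs) []       = refl
  length-addPoly (x ∷ xs) (y ∷ ys) = cong suc (length-addPoly xs ys)

  length-mulPoly : ∀ x xs y ys → length (mulPoly F (x ∷ xs) (y ∷ ys)) ≡ length xs ℕ.+ length (y ∷ ys)
  length-mulPoly x [] y ys = begin
    length (addPoly F (map (x *_) (y ∷ ys)) (0# ∷ []))  ≡⟨ length-addPoly (map (x *_) (y ∷ ys)) (0# ∷ []) ⟩
    suc (length (map (x *_) ys) ℕ.⊔ 0)                  ≡⟨ cong suc (ℕₚ.⊔-identityʳ _) ⟩
    suc (length (map (x *_) ys))                        ≡⟨ cong suc (length-map (x *_) ys) ⟩
    suc (length ys)                                     ∎
    where open ≡-Reasoning
  length-mulPoly x (x′ ∷ xs) y ys = begin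
    length (addPoly F (map (x *_) (y ∷ ys)) (0# ∷ mulPoly F (x′ ∷ xs) (y ∷ ys)))
      ≡⟨ length-addPoly (map (x *_) (y ∷ ys)) (0# ∷ mulPoly F (x′ ∷ xs) (y ∷ ys)) ⟩
    suc (length (map (x *_) ys)) ℕ.⊔ suc (length (mulPoly F (x′ ∷ xs) (y ∷ ys)))
      ≡⟨ cong₂ (λ l l′ → suc l ℕ.⊔ suc l′) (length-map (x *_) ys) (length-mulPoly x′ xs y ys) ⟩
    suc (length ys) ℕ.⊔ suc (length xs ℕ.+ suc (length ys))
      ≡⟨ ℕₚ.m≤n⇒m⊔n≡n (ℕₚ.m≤n⇒m≤1+n (ℕₚ.m≤n+m _ (length xs))) ⟩
    suc (length xs ℕ.+ suc (length ys)) ∎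
    where open ≡-Reasoning

module Trinomial (F : OrderedField) where

  open OrderedField F
  open OrderedFieldProperties F
  open Coefficients F
  open Sequences _≤_
  open IsCommutativeRing isCommutativeRing using (+-identityʳ; *-identityˡ)
  open IsTotalOrder isTotalOrder using (antisym) renaming (refl to ≤-refl; trans to ≤-trans)
  open import Relation.Binary.Construct.NonStrictToStrict _≡_ _≤_ using (<⇒≱)

  timesTrinomial : Carrier → (ℕ → Carrier) → ℕ → Carrier
  timesTrinomial a f i = f i + (a * shift f i + shift (shift f) i)

  coeff-mulPoly-trinomial : ∀ a y ys →
    coeff F (mulPoly F (1# ∷ a ∷ 1# ∷ []) (y ∷ ys)) ≗ timesTrinomial a (coeff F (y ∷ ys))
  coeff-mulPoly-trinomial a y ys i = begin
    coeff F (mulPoly F (1# ∷ a ∷ 1# ∷ []) P) i                ≡⟨ coeff-mulPoly-∷ 1# (a ∷ 1# ∷ []) y ys i ⟩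
    1# * p i + shift (coeff F (mulPoly F (a ∷ 1# ∷ []) P)) i  ≡⟨ cong₂ _+_ (*-identityˡ (p i)) (shift-cong linear i) ⟩
    p i + shift (λ j → a * p j + shift p j) i                 ≡⟨ cong (p i +_) (shift-*-+ a p (shift p) i) ⟩
    timesTrinomial a p i                                      ∎
    where
    open ≡-Reasoning
    P = y ∷ ys
    p = coeff F P
    shift-nil : ∀ j → shift (coeff F []) j ≡ 0#
    shift-nil zero    = refl
    shift-nil (suc j) = refl
    constant : coeff F (mulPoly F (1# ∷ []) P) ≗ p
    constant j = trans (coeff-mulPoly-∷ 1# [] y ys j)
                   (trans (cong (1# * p j +_) (shift-nil j)) (trans (+-identityʳ _) (*-identityˡ (p j))))
    linear : coeff F (mulPoly F (a ∷ 1# ∷ []) P) ≗ λ j → a * p j + shift p j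
    linear j = trans (coeff-mulPoly-∷ a (1# ∷ []) y ys j) (cong (a * p j +_) (shift-cong constant j))

  shift-palindromic : ∀ {T f} → Palindromic T f → f (suc T) ≡ 0# → Palindromic (suc (suc T)) (shift f)
  shift-palindromic {T} pal f[1+T]≡0 zero .(suc (suc T)) refl = sym f[1+T]≡0
  shift-palindromic {T} {f} pal f[1+T]≡0 (suc i) zero 2+i≡2+T =
    trans (cong f (trans (sym (ℕₚ.+-identityʳ i)) (ℕₚ.suc-injective 2+i≡2+T))) f[1+T]≡0
  shift-palindromic pal f[1+T]≡0 (suc i) (suc j) 2+i+j≡2+T =
    pal i j (ℕₚ.suc-injective (trans (sym (ℕₚ.+-suc i j)) (ℕₚ.suc-injective 2+i+j≡2+T)))

  shift-risingTo : ∀ {k f} → 0# ≤ f 0 → RisingTo k f → RisingTo (suc k) (shift f)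
  shift-risingTo 0≤f0 rise zero    _         = 0≤f0
  shift-risingTo 0≤f0 rise (suc i) (s≤s i<k) = rise i i<k

  timesTrinomial-palindromic : ∀ {T f} a → Palindromic T f → f (suc T) ≡ 0# → f (suc (suc T)) ≡ 0# →
                               Palindromic (suc (suc T)) (timesTrinomial a f)
  timesTrinomial-palindromic {T} {f} a pal f[1+T]≡0 f[2+T]≡0 i j i+j≡2+T = begin
    f i + (a * shift f i + shift (shift f) i)
      ≡⟨ cong₂ _+_ (pal² (2 ℕ.+ i) j (cong (2 ℕ.+_) i+j≡2+T))
                   (cong₂ _+_ (cong (a *_) (pal¹ i j i+j≡2+T)) (pal² i (2 ℕ.+ j) i+2+j≡4+T)) ⟩
    shift (shift f) j + (a * shift f j + f j)
      ≡⟨ +-rotate _ _ (f j) ⟩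
    f j + (a * shift f j + shift (shift f) j)
      ∎
    where
    open ≡-Reasoning
    pal¹ : Palindromic (suc (suc T)) (shift f)
    pal¹ = shift-palindromic pal f[1+T]≡0
    pal² : Palindromic (suc (suc (suc (suc T)))) (shift (shift f))
    pal² = shift-palindromic pal¹ f[2+T]≡0
    i+2+j≡4+T : i ℕ.+ suc (suc j) ≡ suc (suc (suc (suc T)))
    i+2+j≡4+T = trans (ℕₚ.+-suc i (suc j)) (cong suc (trans (ℕₚ.+-suc i j) (cong suc i+j≡2+T)))

  timesTrinomial-risingTo : ∀ {k f a} → 0# ≤ a → 0# ≤ f 0 → RisingTo k f → RisingTo k (timesTrinomial a f)
  timesTrinomial-risingTo {k} {f} 0≤a 0≤f0 rise i i<k =
    +-mono-≤ (rise i i<k)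
             (+-mono-≤ (*-monoʳ-≤-nonNeg 0≤a (rise¹ i (ℕₚ.m<n⇒m<1+n i<k)))
                       (shift-risingTo ≤-refl rise¹ i (ℕₚ.m<n⇒m<1+n (ℕₚ.m<n⇒m<1+n i<k))))
    where
    rise¹ : RisingTo (suc k) (shift f)
    rise¹ = shift-risingTo 0≤f0 rise

  timesTrinomial-centralRise : ∀ {m f a} → 1# < a → Palindromic (2 ℕ.* suc m) f → 0# ≤ f 0 →
                               RisingTo (suc m) f → f m ≢ f (suc m) →
                               timesTrinomial a f (suc m) < timesTrinomial a f (suc (suc m))
  timesTrinomial-centralRise {m} {f} {a} 1<a pal 0≤f0 rise fm≢f[1+m] =
    subst (λ x → timesTrinomial a f (suc m) < (x + (a * f (suc m) + f m))) (sym (palindromic-centre-neighbours pal))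
          (centralRise 1<a (shift-risingTo 0≤f0 rise m (ℕₚ.n≤1+n (suc m))) (rise m ℕₚ.≤-refl , fm≢f[1+m]))

  timesTrinomial-uniqueModeOn : ∀ {m f k a} → 1# < a → 0# ≤ f 0 →
    Palindromic (2 ℕ.* suc m) f → (∀ {i} → 2 ℕ.* suc m ℕ.< i → f i ≡ 0#) →
    IsUniqueModeOn (2 ℕ.* suc m) f k →
    Palindromic (2 ℕ.* suc (suc m)) (timesTrinomial a f) ×
    IsUniqueModeOn (2 ℕ.* suc (suc m)) (timesTrinomial a f) (suc (suc m))
  timesTrinomial-uniqueModeOn {m} {f} {k} {a} 1<a@(1≤a , _) 0≤f0 pal vanish uniqueₖ =
    palQ , strictRise⇒uniqueModeOn palQ (risingTo-suc riseQ (proj₁ step)) (<⇒≱ antisym step)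
    where
    uniqueAtCentre : IsUniqueModeOn (2 ℕ.* suc m) f (suc m)
    uniqueAtCentre = subst (IsUniqueModeOn _ f) (uniqueModeOn-palindromic⇒centre pal uniqueₖ) uniqueₖ
    rise : RisingTo (suc m) f
    rise = proj₁ (proj₂ (proj₁ uniqueAtCentre))
    palQ : Palindromic (2 ℕ.* suc (suc m)) (timesTrinomial a f)
    palQ = subst (λ T → Palindromic T (timesTrinomial a f)) (sym (ℕₚ.*-suc 2 (suc m)))
                 (timesTrinomial-palindromic a pal (vanish ℕₚ.≤-refl) (vanish (ℕₚ.n≤1+n _)))
    riseQ : RisingTo (suc m) (timesTrinomial a f)
    riseQ = timesTrinomial-risingTo (≤-trans 0≤1 1≤a) 0≤f0 rise
    step : timesTrinomial a f (suc m) < timesTrinomial a f (suc (suc m))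
    step = timesTrinomial-centralRise 1<a pal 0≤f0 rise (uniqueModeOn⇒strictRise ≤-refl uniqueAtCentre)

open import Data.Nat using (_+_; _*_; _≥_)

lemma2p8 : (F : OrderedField) (n : ℕ) → n ≥ 1 →
    (a : OrderedField.Carrier F) → OrderedField._<_ F (OrderedField.1# F) a →
    (P : List (OrderedField.Carrier F)) →
    length P ≡ suc (2 * n) →
    coeff F P 0 ≡ OrderedField.1# F →
    Symmetric F P →
    UnimodalUniqueMode F P →
    Symmetric F (mulPoly F (OrderedField.1# F ∷ a ∷ OrderedField.1# F ∷ []) P)
    × IsUniqueMode F (mulPoly F (OrderedField.1# F ∷ a ∷ OrderedField.1# F ∷ []) P) (n + 1)
lemma2p8 F n@(suc _) _ a 1<a P@(y ∷ ys) lenP p₀≡1 symmetricP (k , uniqueP) =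
  palindromic⇒∸-symmetric
    (subst (λ T → Palindromic T (coeff F Q)) (sym topQ) (palindromic-resp-≗ coeffQ (proj₁ productFacts))) ,
  subst₂ (λ T j → IsUniqueModeOn T (coeff F Q) j) (sym topQ) (ℕₚ.+-comm 1 n)
         (isUniqueModeOn-resp-≗ coeffQ (proj₂ productFacts))
  where
  open OrderedField F using (0#; 1#; _≤_)
  open OrderedFieldProperties F using (0≤1)
  open Sequences _≤_
  open Coefficients F using (coeff-≥length; length-mulPoly)
  open Trinomial F using (timesTrinomial; coeff-mulPoly-trinomial; timesTrinomial-uniqueModeOn)
  p = coeff F P
  Q = mulPoly F (1# ∷ a ∷ 1# ∷ []) P
  topP : topIndex F P ≡ 2 * n
  topP = cong (_∸ 1) lenP
  topQ : topIndex F Q ≡ 2 * suc n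
  topQ = trans (cong (_∸ 1) (trans (length-mulPoly 1# (a ∷ 1# ∷ []) y ys) (cong (2 +_) lenP)))
               (sym (ℕₚ.*-suc 2 n))
  coeffQ : timesTrinomial a p ≗ coeff F Q
  coeffQ = sym ∘ coeff-mulPoly-trinomial a y ys
  vanishP : ∀ {i} → 2 * n ℕ.< i → p i ≡ 0#
  vanishP {i} 2n<i = coeff-≥length P (subst (ℕ._≤ i) (sym lenP) 2n<i)
  palP : Palindromic (2 * n) p
  palP = subst (λ T → Palindromic T p) topP (∸-symmetric⇒palindromic symmetricP)
  uniqueₖP : IsUniqueModeOn (2 * n) p k
  uniqueₖP = subst (λ T → IsUniqueModeOn T p k) topP uniqueP
  productFacts : Palindromic (2 * suc n) (timesTrinomial a p) ×
                 IsUniqueModeOn (2 * suc n) (timesTrinomial a p) (suc n)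
  productFacts = timesTrinomial-uniqueModeOn 1<a (subst (0# ≤_) (sym p₀≡1) 0≤1) palP vanishP uniqueₖP
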